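{- If $f\in\mathrm{Aut}((\mathbb{F}_2^n)_{[n]})$, then there exist $A\in\mathrm{Aut}(\mathbb{F}_2^n)$ and bijections $\sigma_u:[n]\to[n]$, one for each $u\in\mathbb{F}_2^n$, such that $f((u,j))=(Au,\sigma_u(j))$ for all $u\in\mathbb{F}_2^n$ and $j\in[n]$.
   Context: The complete binary matroid $\mathbb{F}_2^n$ has ground set all vectors of $\mathbb{F}_2^n$, independent sets being the linearly independent sets. For a matroid $\mathbf{M}$ and $k\ge1$, $\mathbf{M}_{[k]}$ has ground set $\{(u,j):u\in\mathbf{M},j\in[k]\}$ and rank function $\mathrm{rank}_{\mathbf{M}_{[k]}}(S)=\mathrm{rank}_{\mathbf{M}}(\{u:(u,j)\in S\})$. $\mathrm{Aut}(\mathbf{M})$ denotes the group of bijections $f$ of the ground set of $\mathbf{M}$ with $\mathrm{rank}(f(S))=\mathrm{rank}(S)$ for all $S$. -}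

module Defs where

open import Data.Bool using (Bool; true; false; if_then_else_; _xor_)
open import Data.Nat using (ℕ; zero; suc; _≤_)
open import Data.Fin using (Fin; zero; suc)
open import Data.Vec using (Vec; replicate; zipWith)
open import Data.List using (List; []; _∷_; length)
open import Data.List.Relation.Unary.All using (All)
open import Data.Product using (Σ; _×_; ∃)
open import Function.Definitions using (Bijective)
open import Relation.Binary.PropositionalEquality using (_≡_)

V : ℕ → Set
V n = Vec Bool n

zeroV : ∀ {n} → V n
zeroV = replicate _ false

_+V_ : ∀ {n} → V n → V n → V n
_+V_ = zipWith _xor_

lincomb : ∀ {n} (I : List (V n)) → (Fin (length I) → Bool) → V n
lincomb [] c = zeroV
lincomb (v ∷ I) c = (if c zero then v else zeroV) +V lincomb I (λ i → c (suc i))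

-- a list of vectors is linearly independent (in particular, it has no repetitions)
LinIndep : ∀ {n} → List (V n) → Set
LinIndep I = ∀ (c : Fin (length I) → Bool) → lincomb I c ≡ zeroV → ∀ i → c i ≡ false

HasRank : ∀ {n} → (V n → Set) → ℕ → Set
HasRank {n} S r =
  (Σ (List (V n)) λ I → All S I × LinIndep I × length I ≡ r)
  × (∀ (I : List (V n)) → All S I → LinIndep I → length I ≤ r)

E : ℕ → ℕ → Set
E n k = V n × Fin k

HasRankK : ∀ {n k} → (E n k → Set) → ℕ → Set
HasRankK {n} {k} S r = HasRank (λ u → ∃ λ (j : Fin k) → S (u Data.Product., j)) r

image : ∀ {A B : Set} → (A → B) → (A → Set) → (B → Set)
image {A} f S y = Σ A λ x → S x × f x ≡ y

IsAut : ∀ {n} → (V n → V n) → Set₁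
IsAut {n} A = Bijective _≡_ _≡_ A
  × (∀ (S : V n → Set) (r : ℕ) → (HasRank (image A S) r → HasRank S r) × (HasRank S r → HasRank (image A S) r))

IsAutK : ∀ {n k} → (E n k → E n k) → Set₁
IsAutK {n} {k} f = Bijective _≡_ _≡_ f
  × (∀ (S : E n k → Set) (r : ℕ) → (HasRankK (image f S) r → HasRankK S r) × (HasRankK S r → HasRankK (image f S) r))

{-# OPTIONS --safe #-}
-- Two points (u , i) and (v , j) of (F₂ⁿ)_[k] satisfy u ≡ v exactly when the sets
-- {(u , i)}, {(u , i), (v , j)} and {(v , j)} all have the same rank: 0 if u = v = 0,
-- 1 if u = v ≠ 0, while for u ≠ v two of these ranks differ. An automorphism preserves
-- and reflects ranks, so it permutes the fibres {u} × [k]; this defines A and the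
-- bijections σ_u, and A preserves ranks because ranks in (F₂ⁿ)_[k] only see first
-- coordinates.
module Submission where

open import Defs
open import Data.Nat as ℕ using (ℕ; _≤_; z≤n; s≤s)
open import Data.Nat.Properties using (≤-antisym)
open import Data.Fin using (Fin; zero; suc)
open import Data.Bool using (Bool; true; false; if_then_else_)
open import Data.Bool.Properties using (xor-identityˡ; xor-identityʳ; xor-assoc; xor-same)
  renaming (_≟_ to _≟ᴮ_)
open import Data.Vec using ([]; _∷_)
open import Data.Vec.Properties using (zipWith-identityˡ; zipWith-identityʳ; zipWith-assoc; ≡-dec)
open import Data.List using (List; length) renaming ([] to []ᴸ; _∷_ to _∷ᴸ_)
open import Data.List.Relation.Unary.All as All using (All) renaming ([] to []ᴬ; _∷_ to _∷ᴬ_)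
open import Data.Product using (Σ; _×_; _,_; proj₁; proj₂; ∃; map₂)
open import Data.Product.Function.NonDependent.Propositional using (_×-⇔_)
open import Data.Sum using (_⊎_; inj₁; inj₂)
open import Data.Empty using (⊥-elim)
open import Function using (_∘_; id; case_of_)
open import Function.Bundles using (_⇔_; mk⇔; Equivalence)
open import Function.Construct.Composition using (_⇔-∘_)
open import Function.Construct.Symmetry using (⇔-sym)
import Function.Construct.Identity as Identity
open import Function.Consequences.Propositional
  using (surjective⇒strictlySurjective; strictlySurjective⇒surjective)
open import Function.Definitions using (Bijective; Injective; StrictlySurjective)
open import Level using (0ℓ)
open import Relation.Nullary using (¬_; Dec; yes; no)
open import Relation.Unary using (Pred; ｛_｝; _∪_; _≐_)
open import Relation.Unary.Properties using (≐-sym; ≐-trans)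
open import Relation.Binary.PropositionalEquality
open ≡-Reasoning

open Equivalence using (to; from)

private
  variable
    n k r : ℕ

+V-identityˡ : (x : V n) → zeroV +V x ≡ x
+V-identityˡ = zipWith-identityˡ xor-identityˡ

+V-identityʳ : (x : V n) → x +V zeroV ≡ x
+V-identityʳ = zipWith-identityʳ xor-identityʳ

+V-assoc : (x y z : V n) → (x +V y) +V z ≡ x +V (y +V z)
+V-assoc = zipWith-assoc xor-assoc

+V-self : (x : V n) → x +V x ≡ zeroV
+V-self []      = refl
+V-self (b ∷ x) = cong₂ _∷_ (xor-same b) (+V-self x)

x+y≡zero⇒x≡y : (x y : V n) → x +V y ≡ zeroV → x ≡ y
x+y≡zero⇒x≡y x y x+y≡0 = begin
  x                 ≡⟨ sym (+V-identityʳ x) ⟩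
  x +V zeroV        ≡⟨ cong (x +V_) (sym (+V-self y)) ⟩
  x +V (y +V y)     ≡⟨ sym (+V-assoc x y y) ⟩
  (x +V y) +V y     ≡⟨ cong (_+V y) x+y≡0 ⟩
  zeroV +V y        ≡⟨ +V-identityˡ y ⟩
  y                 ∎

_≟V_ : (x y : V n) → Dec (x ≡ y)
_≟V_ = ≡-dec _≟ᴮ_

lincomb-false : (I : List (V n)) → lincomb I (λ _ → false) ≡ zeroV
lincomb-false []ᴸ      = refl
lincomb-false (v ∷ᴸ I) = trans (+V-identityˡ _) (lincomb-false I)

independent-head-nonzero : {w : V n} {I : List (V n)} → LinIndep (w ∷ᴸ I) → w ≢ zeroV
independent-head-nonzero {w = w} {I} independent w≡0 =
  case independent head head-sum≡0 zero of λ ()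
  where
  head : Fin (ℕ.suc (length I)) → Bool
  head zero    = true
  head (suc _) = false
  head-sum≡0 : lincomb (w ∷ᴸ I) head ≡ zeroV
  head-sum≡0 = trans (cong (w +V_) (lincomb-false I)) (trans (+V-identityʳ w) w≡0)

independent-no-repeated-head : {w : V n} {I : List (V n)} → ¬ LinIndep (w ∷ᴸ w ∷ᴸ I)
independent-no-repeated-head {w = w} {I} independent =
  case independent first-two first-two-sum≡0 zero of λ ()
  where
  first-two : Fin (ℕ.suc (ℕ.suc (length I))) → Bool
  first-two zero          = true
  first-two (suc zero)    = true
  first-two (suc (suc _)) = false
  first-two-sum≡0 : lincomb (w ∷ᴸ w ∷ᴸ I) first-two ≡ zeroV
  first-two-sum≡0 = begin
    w +V (w +V lincomb I (λ _ → false)) ≡⟨ cong (λ z → w +V (w +V z)) (lincomb-false I) ⟩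
    w +V (w +V zeroV)                   ≡⟨ cong (w +V_) (+V-identityʳ w) ⟩
    w +V w                              ≡⟨ +V-self w ⟩
    zeroV                               ∎

singleton-independent : {w : V n} → w ≢ zeroV → LinIndep (w ∷ᴸ []ᴸ)
singleton-independent {w = w} w≢0 c sum≡0 zero with c zero
... | false = refl
... | true  = ⊥-elim (w≢0 (trans (sym (+V-identityʳ w)) sum≡0))

pair-independent : {w₁ w₂ : V n} → w₁ ≢ zeroV → w₂ ≢ zeroV → w₁ ≢ w₂ →
                   LinIndep (w₁ ∷ᴸ w₂ ∷ᴸ []ᴸ)
pair-independent {w₁ = w₁} {w₂} w₁≢0 w₂≢0 w₁≢w₂ c sum≡0 =
  λ { zero → proj₁ coefficients ; (suc zero) → proj₂ coefficients }
  where
  coefficients-false : ∀ a b →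
    (if a then w₁ else zeroV) +V ((if b then w₂ else zeroV) +V zeroV) ≡ zeroV →
    a ≡ false × b ≡ false
  coefficients-false false false _ = refl , refl
  coefficients-false true  false e =
    ⊥-elim (w₁≢0 (trans (sym (trans (cong (w₁ +V_) (+V-identityˡ zeroV)) (+V-identityʳ w₁))) e))
  coefficients-false false true  e =
    ⊥-elim (w₂≢0 (trans (sym (trans (+V-identityˡ _) (+V-identityʳ w₂))) e))
  coefficients-false true  true  e =
    ⊥-elim (w₁≢w₂ (x+y≡zero⇒x≡y w₁ w₂ (trans (sym (cong (w₁ +V_) (+V-identityʳ w₂))) e)))
  coefficients : c zero ≡ false × c (suc zero) ≡ false
  coefficients = coefficients-false (c zero) (c (suc zero)) sum≡0

independent-in-singleton : {w : V n} {I : List (V n)} → All (w ≡_) I → LinIndep I → length I ≤ 1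
independent-in-singleton []ᴬ         _ = z≤n
independent-in-singleton (_ ∷ᴬ []ᴬ) _ = s≤s z≤n
independent-in-singleton {I = _ ∷ᴸ _ ∷ᴸ I} (refl ∷ᴬ refl ∷ᴬ _) independent =
  ⊥-elim (independent-no-repeated-head {I = I} independent)

HasRank-cong : {S T : Pred (V n) 0ℓ} → S ≐ T → HasRank S r → HasRank T r
HasRank-cong (S⊆T , T⊆S) ((I , I⊆S , independent , length≡r) , maximal) =
  (I , All.map S⊆T I⊆S , independent , length≡r) ,
  λ J J⊆T → maximal J (All.map T⊆S J⊆T)

HasRank-unique : {S : Pred (V n) 0ℓ} {r s : ℕ} → HasRank S r → HasRank S s → r ≡ s
HasRank-unique ((I , I⊆S , I-independent , refl) , r-maximal)
               ((J , J⊆S , J-independent , refl) , s-maximal) =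
  ≤-antisym (s-maximal I I⊆S I-independent) (r-maximal J J⊆S J-independent)

rank-0-members : {S : Pred (V n) 0ℓ} {w : V n} → HasRank S 0 → S w → w ≡ zeroV
rank-0-members {w = w} (_ , maximal) w∈S with w ≟V zeroV
... | yes w≡0 = w≡0
... | no  w≢0 with maximal (w ∷ᴸ []ᴸ) (w∈S ∷ᴬ []ᴬ) (singleton-independent w≢0)
... | ()

rank-1-members : {S : Pred (V n) 0ℓ} {w₁ w₂ : V n} → HasRank S 1 → S w₁ → S w₂ →
                 w₁ ≢ zeroV → w₂ ≢ zeroV → w₁ ≡ w₂
rank-1-members {w₁ = w₁} {w₂} (_ , maximal) w₁∈S w₂∈S w₁≢0 w₂≢0 with w₁ ≟V w₂
... | yes w₁≡w₂ = w₁≡w₂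
... | no  w₁≢w₂
  with maximal (w₁ ∷ᴸ w₂ ∷ᴸ []ᴸ) (w₁∈S ∷ᴬ w₂∈S ∷ᴬ []ᴬ) (pair-independent w₁≢0 w₂≢0 w₁≢w₂)
... | s≤s ()

singleton-zero-rank : HasRank ｛ zeroV {n} ｝ 0
singleton-zero-rank = ([]ᴸ , []ᴬ , (λ _ _ ()) , refl) , maximal
  where
  maximal : ∀ I → All ｛ zeroV ｝ I → LinIndep I → length I ≤ 0
  maximal []ᴸ      _           _           = z≤n
  maximal (_ ∷ᴸ I) (refl ∷ᴬ _) independent =
    ⊥-elim (independent-head-nonzero {I = I} independent refl)

singleton-nonzero-rank : {w : V n} → w ≢ zeroV → HasRank ｛ w ｝ 1
singleton-nonzero-rank {w = w} w≢0 =
  (w ∷ᴸ []ᴸ , refl ∷ᴬ []ᴬ , singleton-independent w≢0 , refl) ,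
  λ _ → independent-in-singleton

singleton-rank : (w : V n) → ∃ (HasRank ｛ w ｝)
singleton-rank w with w ≟V zeroV
... | yes refl = 0 , singleton-zero-rank
... | no  w≢0  = 1 , singleton-nonzero-rank w≢0

singleton-rank-cases : {w : V n} → HasRank ｛ w ｝ r → (w ≡ zeroV × r ≡ 0) ⊎ (w ≢ zeroV × r ≡ 1)
singleton-rank-cases {w = w} rank≡r with w ≟V zeroV
... | yes refl = inj₁ (refl , HasRank-unique rank≡r singleton-zero-rank)
... | no  w≢0  = inj₂ (w≢0 , HasRank-unique rank≡r (singleton-nonzero-rank w≢0))

SameRanks : V n → V n → ℕ → Set
SameRanks u v r = HasRank ｛ u ｝ r × HasRank (｛ u ｝ ∪ ｛ v ｝) r × HasRank ｛ v ｝ r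

sameRanks⇒≡ : {u v : V n} → SameRanks u v r → u ≡ v
sameRanks⇒≡ (rank-u , rank-uv , rank-v)
  with singleton-rank-cases rank-u | singleton-rank-cases rank-v
... | inj₁ (u≡0 , _)    | inj₁ (v≡0 , _)   = trans u≡0 (sym v≡0)
... | inj₂ (u≢0 , refl) | inj₂ (v≢0 , _)   = rank-1-members rank-uv (inj₁ refl) (inj₂ refl) u≢0 v≢0
... | inj₁ (_ , refl)   | inj₂ (_ , ())
... | inj₂ (_ , refl)   | inj₁ (_ , ())

≡⇔sameRanks : {u v : V n} → u ≡ v ⇔ ∃ (SameRanks u v)
≡⇔sameRanks {u = u} = mk⇔ (λ { refl → sameRanks-refl }) (sameRanks⇒≡ ∘ proj₂)
  where
  ｛u｝≐｛u｝∪｛u｝ : ｛ u ｝ ≐ ｛ u ｝ ∪ ｛ u ｝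
  ｛u｝≐｛u｝∪｛u｝ = inj₁ , λ { (inj₁ e) → e ; (inj₂ e) → e }
  sameRanks-refl : ∃ (SameRanks u u)
  sameRanks-refl =
    map₂ (λ rank-u → rank-u , HasRank-cong ｛u｝≐｛u｝∪｛u｝ rank-u , rank-u) (singleton-rank u)

image-id : {A : Set} {S : Pred A 0ℓ} → image id S ≐ S
image-id = (λ { (_ , x∈S , refl) → x∈S }) , (λ x∈S → _ , x∈S , refl)

image-｛｝ : {A B : Set} {f : A → B} {x : A} → image f ｛ x ｝ ≐ ｛ f x ｝
image-｛｝ {x = x} = (λ { (_ , refl , refl) → refl }) , (λ { refl → x , refl , refl })

image-pair : {A B : Set} {f : A → B} {x y : A} → image f (｛ x ｝ ∪ ｛ y ｝) ≐ ｛ f x ｝ ∪ ｛ f y ｝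
image-pair {x = x} {y} =
  (λ { (_ , inj₁ refl , refl) → inj₁ refl ; (_ , inj₂ refl , refl) → inj₂ refl }) ,
  (λ { (inj₁ refl) → x , inj₁ refl , refl ; (inj₂ refl) → y , inj₂ refl , refl })

-- HasRankK S r unfolds to HasRank (underlying S) r.
underlying : Pred (E n k) 0ℓ → Pred (V n) 0ℓ
underlying S u = ∃ λ j → S (u , j)

underlying-cong : {S T : Pred (E n k) 0ℓ} → S ≐ T → underlying S ≐ underlying T
underlying-cong (S⊆T , T⊆S) = map₂ S⊆T , map₂ T⊆S

underlying-｛｝ : {p : E n k} → underlying ｛ p ｝ ≐ ｛ proj₁ p ｝
underlying-｛｝ {p = u , j} = (λ { (_ , refl) → refl }) , (λ { refl → j , refl })

underlying-pair : {p q : E n k} → underlying (｛ p ｝ ∪ ｛ q ｝) ≐ ｛ proj₁ p ｝ ∪ ｛ proj₁ q ｝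
underlying-pair {p = u , i} {v , j} =
  (λ { (_ , inj₁ refl) → inj₁ refl ; (_ , inj₂ refl) → inj₂ refl }) ,
  (λ { (inj₁ refl) → i , inj₁ refl ; (inj₂ refl) → j , inj₂ refl })

rank-transfer : {f : E n k → E n k} → IsAutK f →
                {S : Pred (E n k) 0ℓ} {T T′ : Pred (V n) 0ℓ} →
                underlying S ≐ T → underlying (image f S) ≐ T′ → HasRank T r ⇔ HasRank T′ r
rank-transfer {r = r} (_ , preserves) {S} S≐T fS≐T′ = mk⇔
  (HasRank-cong fS≐T′ ∘ proj₂ (preserves S r) ∘ HasRank-cong (≐-sym S≐T))
  (HasRank-cong S≐T ∘ proj₁ (preserves S r) ∘ HasRank-cong (≐-sym fS≐T′))

fibres-preserved : {f : E n k → E n k} → IsAutK f →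
                   {p q : E n k} → proj₁ p ≡ proj₁ q ⇔ proj₁ (f p) ≡ proj₁ (f q)
fibres-preserved {f = f} aut {p} {q} =
  ⇔-sym ≡⇔sameRanks ⇔-∘ (sameRanks-transfer ⇔-∘ ≡⇔sameRanks)
  where
  singleton-transfer : ∀ {x r} → HasRank ｛ proj₁ x ｝ r ⇔ HasRank ｛ proj₁ (f x) ｝ r
  singleton-transfer =
    rank-transfer aut underlying-｛｝ (≐-trans (underlying-cong image-｛｝) underlying-｛｝)
  pair-transfer : ∀ {r} → HasRank (｛ proj₁ p ｝ ∪ ｛ proj₁ q ｝) r
                        ⇔ HasRank (｛ proj₁ (f p) ｝ ∪ ｛ proj₁ (f q) ｝) r
  pair-transfer =
    rank-transfer aut underlying-pair (≐-trans (underlying-cong image-pair) underlying-pair)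
  sameRanks-transfer : ∃ (SameRanks (proj₁ p) (proj₁ q)) ⇔ ∃ (SameRanks (proj₁ (f p)) (proj₁ (f q)))
  sameRanks-transfer = mk⇔ (map₂ (to same)) (map₂ (from same))
    where
    same : ∀ {r} → SameRanks (proj₁ p) (proj₁ q) r ⇔ SameRanks (proj₁ (f p)) (proj₁ (f q)) r
    same = singleton-transfer ×-⇔ (pair-transfer ×-⇔ singleton-transfer)

module Decomposition {n k : ℕ} {f : E n k → E n k} (aut : IsAutK f) (j₀ : Fin k) where

  A : V n → V n
  A u = proj₁ (f (u , j₀))

  σ : V n → Fin k → Fin k
  σ u j = proj₂ (f (u , j))

  f-decomposes : ∀ u j → f (u , j) ≡ (A u , σ u j)
  f-decomposes u j = cong (_, σ u j) (to (fibres-preserved aut) refl)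

  f-surjective : StrictlySurjective _≡_ f
  f-surjective = surjective⇒strictlySurjective (proj₂ (proj₁ aut))

  A-injective : Injective _≡_ _≡_ A
  A-injective = from (fibres-preserved aut)

  A-surjective : StrictlySurjective _≡_ A
  A-surjective v with f-surjective (v , j₀)
  ... | x , fx≡[v,j₀] = proj₁ x , trans (to (fibres-preserved aut) refl) (cong proj₁ fx≡[v,j₀])

  A-preserves-rank : ∀ S r → HasRank S r ⇔ HasRank (image A S) r
  A-preserves-rank S r = rank-transfer aut {S = S ∘ proj₁} underlying-∘proj₁ underlying-image
    where
    underlying-∘proj₁ : underlying (S ∘ proj₁) ≐ S
    underlying-∘proj₁ = proj₂ , (j₀ ,_)
    underlying-image : underlying (image f (S ∘ proj₁)) ≐ image A S
    underlying-image =
      (λ { (_ , x , x∈S , refl) → proj₁ x , x∈S , to (fibres-preserved aut) refl }) ,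
      (λ { (u , u∈S , refl) → σ u j₀ , (u , j₀) , u∈S , refl })

  A-isAut : IsAut A
  A-isAut = (A-injective , strictlySurjective⇒surjective A-surjective) ,
            λ S r → from (A-preserves-rank S r) , to (A-preserves-rank S r)

  σ-bijective : ∀ u → Bijective _≡_ _≡_ (σ u)
  σ-bijective u = σ-injective , strictlySurjective⇒surjective σ-surjective
    where
    σ-injective : Injective _≡_ _≡_ (σ u)
    σ-injective σj≡σj′ =
      cong proj₂ (proj₁ (proj₁ aut) (cong₂ _,_ (to (fibres-preserved aut) refl) σj≡σj′))
    σ-surjective : StrictlySurjective _≡_ (σ u)
    σ-surjective j with f-surjective (A u , j)
    ... | (u′ , j′) , f[u′,j′]≡[Au,j]
      with A-injective (trans (to (fibres-preserved aut) refl) (cong proj₁ f[u′,j′]≡[Au,j]))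
    ... | refl = j′ , cong proj₂ f[u′,j′]≡[Au,j]

id-isAut : IsAut {n} id
id-isAut = Identity.bijective _≡_ , λ S r → HasRank-cong image-id , HasRank-cong (≐-sym image-id)

automorphism-decomposition : {f : E n k → E n k} → IsAutK f →
  Σ (V n → V n) λ A → Σ (V n → Fin k → Fin k) λ σ →
    IsAut A × (∀ u → Bijective _≡_ _≡_ (σ u)) × (∀ u j → f (u , j) ≡ (A u , σ u j))
automorphism-decomposition {k = 0}       _   =
  id , (λ _ → id) , id-isAut , (λ _ → Identity.bijective _≡_) , λ _ ()
automorphism-decomposition {k = ℕ.suc _} aut =
  A , σ , A-isAut , σ-bijective , f-decomposes
  where open Decomposition aut zero

lemma4 : (n : ℕ) (f : E n n → E n n) → IsAutK f →
    Σ (V n → V n) λ A → Σ (V n → Fin n → Fin n) λ σ →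
      IsAut A × (∀ u → Bijective _≡_ _≡_ (σ u)) × (∀ u j → f (u , j) ≡ (A u , σ u j))
lemma4 n f = automorphism-decomposition
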